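{- For every integer $k\ge1$: (a) $H_k\,\varphi^k(1)\,H_k = 2^k\operatorname{diag}\big(J_{k+1},\,J_k,\,J_{k-1}\rho^1(1),\,J_{k-2}\rho^2(1),\,\dots,\,J_1\rho^{k-1}(1)\big)$; (b) $H_k\,\varphi^k(0)\,H_k = 2^{k+1}\operatorname{diag}\big(J_{k},\,J_{k-1},\,J_{k-2}\rho^1(1),\,\dots,\,J_1\rho^{k-2}(1),\,J_0\rho^{k-1}(1)\big)$. Here the argument of $\operatorname{diag}$ is the concatenation (a vector of length $2^k$) of the listed scalars and scaled vectors; in (a) the terms are $J_{k+1}$, $J_k$, and $J_{k-m}\rho^m(1)$ for $m=1,\dots,k-1$; in (b) they are $J_k$, $J_{k-1}$, and $J_{k-1-m}\rho^m(1)$ for $m=1,\dots,k-1$.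
   Context: $J_n=(2^n-(-1)^n)/3$ are the Jacobsthal numbers. $H_k=\gamma^k(1)$ is the $2^k\times2^k$ Hadamard matrix defined by $H_0=[1]$ and $H_{k+1}=\begin{bmatrix}H_k&H_k\\H_k&-H_k\end{bmatrix}$. The $2^k\times 2^k$ matrices $\varphi^k(1),\varphi^k(0)$ are defined by $\varphi^0(1)=[1]$, $\varphi^0(0)=[0]$ and $\varphi^{k+1}(1)=\begin{bmatrix}\varphi^k(1)&\varphi^k(0)\\\varphi^k(0)&\varphi^k(1)\end{bmatrix}$, $\varphi^{k+1}(0)=\begin{bmatrix}\varphi^k(1)&\varphi^k(1)\\\varphi^k(1)&\varphi^k(1)\end{bmatrix}$ (iterates of the 2-D morphism $1\mapsto\begin{bmatrix}1&0\\0&1\end{bmatrix}$, $0\mapsto\begin{bmatrix}1&1\\1&1\end{bmatrix}$). The vectors $\rho^m(1)\in\{\pm1\}^{2^m}$ are iterates of the morphism $\rho(1)=(-1,1)$, $\rho(-1)=(1,-1)$: $\rho^0(1)=(1)$ and $\rho^{m+1}(1)$ is obtained by replacing each entry $x$ of $\rho^m(1)$ by $\rho(x)$ and concatenating (e.g. $\rho^2(1)=(1,-1,-1,1)$). For a vector $v=(a_1,\dots,a_n)$, $\operatorname{diag}(v)$ is the diagonal matrix with diagonal entries $a_1,\dots,a_n$. -}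

module Defs where

open import Data.Nat using (ℕ; zero; suc; _∸_)
open import Data.Integer using (ℤ; +_; _+_; _-_; _*_; -_; _^_)
open import Data.Integer.DivMod using (_/ℕ_)
open import Data.List using (List; []; _∷_; _++_; map; zipWith; foldr; replicate; length; concat; concatMap; upTo; drop; [_])

-- Matrices are represented as lists of rows (lists of integers).
Matrix : Set
Matrix = List (List ℤ)

-- Jacobsthal numbers J_n = (2^n - (-1)^n)/3  (exact division)
J : ℕ → ℤ
J n = ((+ 2) ^ n - (- + 1) ^ n) /ℕ 3

block : Matrix → Matrix → Matrix → Matrix → Matrix
block A B C D = zipWith _++_ A B ++ zipWith _++_ C D

negM : Matrix → Matrix
negM = map (map (λ x → - x))

scaleM : ℤ → Matrix → Matrix
scaleM c = map (map (c *_))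

transpose : Matrix → Matrix
transpose []          = []
transpose (r ∷ rs) = foldr (zipWith _∷_) (replicate (length r) []) (r ∷ rs)

dot : List ℤ → List ℤ → ℤ
dot u v = foldr _+_ (+ 0) (zipWith _*_ u v)

_⊗_ : Matrix → Matrix → Matrix
A ⊗ B = map (λ row → map (dot row) (transpose B)) A

H : ℕ → Matrix
H zero    = [ [ + 1 ] ]
H (suc k) = block (H k) (H k) (H k) (negM (H k))

φ1 : ℕ → Matrix
φ0 : ℕ → Matrix
φ1 zero    = [ [ + 1 ] ]
φ1 (suc k) = block (φ1 k) (φ0 k) (φ0 k) (φ1 k)
φ0 zero    = [ [ + 0 ] ]
φ0 (suc k) = block (φ1 k) (φ1 k) (φ1 k) (φ1 k)

ρ : ℤ → List ℤ
ρ x = - x ∷ x ∷ []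

ρpow : ℕ → List ℤ
ρpow zero    = [ + 1 ]
ρpow (suc m) = concatMap ρ (ρpow m)

diag : List ℤ → Matrix
diag []       = []
diag (x ∷ xs) = (x ∷ replicate (length xs) (+ 0)) ∷ map (+ 0 ∷_) (diag xs)

scaleV : ℤ → List ℤ → List ℤ
scaleV c = map (c *_)

range1 : ℕ → List ℕ
range1 k = drop 1 (upTo k)

diagA : ℕ → List ℤ
diagA k = J (suc k) ∷ J k ∷ concatMap (λ m → scaleV (J (k ∸ m)) (ρpow m)) (range1 k)

diagB : ℕ → List ℤ
diagB k = J k ∷ J (k ∸ 1) ∷ concatMap (λ m → scaleV (J (k ∸ 1 ∸ m)) (ρpow m)) (range1 k)

-- Write H_{k+1} = [[h, h], [h, -h]], φ^{k+1}(1) = [[p, q], [q, p]] and φ^{k+1}(0) = [[p, p], [p, p]]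
-- with h = H_k, p = φ^k(1), q = φ^k(0).  By bilinearity,
--   H_{k+1} φ^{k+1}(1) H_{k+1} = [[2(A + B), 0], [0, 2(A - B)]],  H_{k+1} φ^{k+1}(0) H_{k+1} = [[4A, 0], [0, 0]]
-- where A = h p h and B = h q h.  So both products are diagonal, and after dividing out the powers of 2
-- their diagonals a, b evolve as a ↦ (a + 2b, a - 2b) and b ↦ (a, 0).  The Jacobsthal identities
-- J_{n+2} = J_{n+1} + 2 J_n and J_{n+1} - 2 J_n = (-1)^n, together with ρ^{m+1}(1) = (-ρ^m(1), ρ^m(1)),
-- show that the diagonals of the statement obey the same recursion.  Block algebra is done on quadtrees,
-- where it is structural, and transported to the row-list matrices at the end.

module Submission where

open import Defs
open import Data.Nat as ℕ using (ℕ; zero; suc; _≤_; _<_; _∸_; _⊓_) renaming (_+_ to _+ℕ_)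
import Data.Nat.Properties as ℕₚ
open import Data.Nat.DivMod using (m*n/n≡m)
open import Data.Integer using (ℤ; +_; _+_; _-_; _*_; -_; _^_; _/ℕ_)
open import Data.List using (List; []; _∷_; _++_; map; zipWith; foldr; replicate; length; [_]; take; drop; concatMap)
import Data.List.Properties as Listₚ
open import Data.List.Relation.Unary.All using (All; []; _∷_)
open import Data.List.Relation.Unary.All.Properties using (++⁺; drop⁺; all-upTo)
open import Data.Product using (_×_; _,_; proj₁; proj₂)
open import Relation.Binary.PropositionalEquality hiding ([_]; J)
import Data.Integer.Properties as ℤₚ
open import Algebra.Properties.CommutativeSemigroup ℤₚ.+-commutativeSemigroup
  using () renaming (interchange to +-interchange)
open import Data.Integer.Tactic.RingSolver using (solve-∀)

cong₄ : ∀ {A B : Set} (f : A → A → A → A → B) {a b c d a′ b′ c′ d′} →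
        a ≡ a′ → b ≡ b′ → c ≡ c′ → d ≡ d′ → f a b c d ≡ f a′ b′ c′ d′
cong₄ f refl refl refl refl = refl

-- Quadtree matrices

record Quad (A : Set) : Set where
  constructor quad
  field
    upperLeft upperRight lowerLeft lowerRight : A

Q : ℕ → Set
Q zero    = ℤ
Q (suc k) = Quad (Q k)

mapQ : ∀ k → (ℤ → ℤ) → Q k → Q k
mapQ zero    f x              = f x
mapQ (suc k) f (quad a b c d) = quad (mapQ k f a) (mapQ k f b) (mapQ k f c) (mapQ k f d)

zipWithQ : ∀ k → (ℤ → ℤ → ℤ) → Q k → Q k → Q k
zipWithQ zero    f x              y                  = f x y
zipWithQ (suc k) f (quad a b c d) (quad a′ b′ c′ d′) =
  quad (zipWithQ k f a a′) (zipWithQ k f b b′) (zipWithQ k f c c′) (zipWithQ k f d d′)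

zeroQ : ∀ k → Q k
zeroQ zero    = + 0
zeroQ (suc k) = quad (zeroQ k) (zeroQ k) (zeroQ k) (zeroQ k)

addQ : ∀ k → Q k → Q k → Q k
addQ k = zipWithQ k _+_

negQ : ∀ k → Q k → Q k
negQ k = mapQ k (λ x → - x)

mulQ : ∀ k → Q k → Q k → Q k
mulQ zero    x              y              = x * y
mulQ (suc k) (quad a b c d) (quad e f g h) =
  quad (addQ k (mulQ k a e) (mulQ k b g)) (addQ k (mulQ k a f) (mulQ k b h))
       (addQ k (mulQ k c e) (mulQ k d g)) (addQ k (mulQ k c f) (mulQ k d h))

transposeQ : ∀ k → Q k → Q k
transposeQ zero    x              = x
transposeQ (suc k) (quad a b c d) = quad (transposeQ k a) (transposeQ k c) (transposeQ k b) (transposeQ k d)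

-- Syntax of entrywise operations on two matrices, so that identities between them can be
-- transferred from ℤ at once.

data Entrywise : Set where
  ‵x ‵y ‵0 : Entrywise
  ‵op₁     : (ℤ → ℤ) → Entrywise → Entrywise
  ‵op₂     : (ℤ → ℤ → ℤ) → Entrywise → Entrywise → Entrywise

evalℤ : Entrywise → ℤ → ℤ → ℤ
evalℤ ‵x           x y = x
evalℤ ‵y           x y = y
evalℤ ‵0           x y = + 0
evalℤ (‵op₁ f e)    x y = f (evalℤ e x y)
evalℤ (‵op₂ f e e′) x y = f (evalℤ e x y) (evalℤ e′ x y)

evalQ : ∀ k → Entrywise → Q k → Q k → Q k
evalQ k ‵x           X Y = X
evalQ k ‵y           X Y = Y
evalQ k ‵0           X Y = zeroQ k
evalQ k (‵op₁ f e)    X Y = mapQ k f (evalQ k e X Y)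
evalQ k (‵op₂ f e e′) X Y = zipWithQ k f (evalQ k e X Y) (evalQ k e′ X Y)

infixl 6 _‵+_
infix  8 ‵-_

_‵+_ : Entrywise → Entrywise → Entrywise
_‵+_ = ‵op₂ _+_

‵-_ : Entrywise → Entrywise
‵-_ = ‵op₁ (λ x → - x)

evalQ-zero : ∀ e x y → evalQ zero e x y ≡ evalℤ e x y
evalQ-zero ‵x           x y = refl
evalQ-zero ‵y           x y = refl
evalQ-zero ‵0           x y = refl
evalQ-zero (‵op₁ f e)    x y = cong f (evalQ-zero e x y)
evalQ-zero (‵op₂ f e e′) x y = cong₂ f (evalQ-zero e x y) (evalQ-zero e′ x y)

evalQ-quad : ∀ k e a b c d a′ b′ c′ d′ →
  evalQ (suc k) e (quad a b c d) (quad a′ b′ c′ d′)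
    ≡ quad (evalQ k e a a′) (evalQ k e b b′) (evalQ k e c c′) (evalQ k e d d′)
evalQ-quad k ‵x           a b c d a′ b′ c′ d′ = refl
evalQ-quad k ‵y           a b c d a′ b′ c′ d′ = refl
evalQ-quad k ‵0           a b c d a′ b′ c′ d′ = refl
evalQ-quad k (‵op₁ f e)    a b c d a′ b′ c′ d′ =
  cong (mapQ (suc k) f) (evalQ-quad k e a b c d a′ b′ c′ d′)
evalQ-quad k (‵op₂ f e e′) a b c d a′ b′ c′ d′ =
  cong₂ (zipWithQ (suc k) f) (evalQ-quad k e a b c d a′ b′ c′ d′) (evalQ-quad k e′ a b c d a′ b′ c′ d′)

entrywise-identity : ∀ k e e′ → (∀ x y → evalℤ e x y ≡ evalℤ e′ x y) →
                     ∀ X Y → evalQ k e X Y ≡ evalQ k e′ X Y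
entrywise-identity zero e e′ eq x y =
  trans (evalQ-zero e x y) (trans (eq x y) (sym (evalQ-zero e′ x y)))
entrywise-identity (suc k) e e′ eq (quad a b c d) (quad a′ b′ c′ d′) =
  trans (evalQ-quad k e a b c d a′ b′ c′ d′)
    (trans (cong₄ quad (entrywise-identity k e e′ eq a a′) (entrywise-identity k e e′ eq b b′)
                       (entrywise-identity k e e′ eq c c′) (entrywise-identity k e e′ eq d d′))
           (sym (evalQ-quad k e′ a b c d a′ b′ c′ d′)))

addQ-interchange : ∀ k w x y z → addQ k (addQ k w x) (addQ k y z) ≡ addQ k (addQ k w y) (addQ k x z)
addQ-interchange zero = +-interchange
addQ-interchange (suc k) (quad a b c d) (quad a′ b′ c′ d′) (quad e f g h) (quad e′ f′ g′ h′) =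
  cong₄ quad (addQ-interchange k a a′ e e′) (addQ-interchange k b b′ f f′)
             (addQ-interchange k c c′ g g′) (addQ-interchange k d d′ h h′)

negQ-distrib-addQ : ∀ k x y → addQ k (negQ k x) (negQ k y) ≡ negQ k (addQ k x y)
negQ-distrib-addQ zero x y = sym (ℤₚ.neg-distrib-+ x y)
negQ-distrib-addQ (suc k) (quad a b c d) (quad a′ b′ c′ d′) =
  cong₄ quad (negQ-distrib-addQ k a a′) (negQ-distrib-addQ k b b′)
             (negQ-distrib-addQ k c c′) (negQ-distrib-addQ k d d′)

mulQ-distribʳ-addQ : ∀ k x y z → mulQ k (addQ k x y) z ≡ addQ k (mulQ k x z) (mulQ k y z)
mulQ-distribʳ-addQ zero x y z = ℤₚ.*-distribʳ-+ z x y
mulQ-distribʳ-addQ (suc k) (quad a b c d) (quad a′ b′ c′ d′) (quad e f g h) =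
  cong₄ quad (entry a a′ b b′ e g) (entry a a′ b b′ f h) (entry c c′ d d′ e g) (entry c c′ d d′ f h)
  where
  entry : ∀ a a′ b b′ e g →
    addQ k (mulQ k (addQ k a a′) e) (mulQ k (addQ k b b′) g)
      ≡ addQ k (addQ k (mulQ k a e) (mulQ k b g)) (addQ k (mulQ k a′ e) (mulQ k b′ g))
  entry a a′ b b′ e g =
    trans (cong₂ (addQ k) (mulQ-distribʳ-addQ k a a′ e) (mulQ-distribʳ-addQ k b b′ g))
          (addQ-interchange k _ _ _ _)

mulQ-negQˡ : ∀ k x z → mulQ k (negQ k x) z ≡ negQ k (mulQ k x z)
mulQ-negQˡ zero x z = sym (ℤₚ.neg-distribˡ-* x z)
mulQ-negQˡ (suc k) (quad a b c d) (quad e f g h) =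
  cong₄ quad (entry a b e g) (entry a b f h) (entry c d e g) (entry c d f h)
  where
  entry : ∀ a b e g →
    addQ k (mulQ k (negQ k a) e) (mulQ k (negQ k b) g) ≡ negQ k (addQ k (mulQ k a e) (mulQ k b g))
  entry a b e g = trans (cong₂ (addQ k) (mulQ-negQˡ k a e) (mulQ-negQˡ k b g)) (negQ-distrib-addQ k _ _)

mulQ-negQʳ : ∀ k x z → mulQ k x (negQ k z) ≡ negQ k (mulQ k x z)
mulQ-negQʳ zero x z = sym (ℤₚ.neg-distribʳ-* x z)
mulQ-negQʳ (suc k) (quad a b c d) (quad e f g h) =
  cong₄ quad (entry a b e g) (entry a b f h) (entry c d e g) (entry c d f h)
  where
  entry : ∀ a b e g →
    addQ k (mulQ k a (negQ k e)) (mulQ k b (negQ k g)) ≡ negQ k (addQ k (mulQ k a e) (mulQ k b g))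
  entry a b e g = trans (cong₂ (addQ k) (mulQ-negQʳ k a e) (mulQ-negQʳ k b g)) (negQ-distrib-addQ k _ _)

transposeQ-involutive : ∀ k x → transposeQ k (transposeQ k x) ≡ x
transposeQ-involutive zero    x              = refl
transposeQ-involutive (suc k) (quad a b c d) =
  cong₄ quad (transposeQ-involutive k a) (transposeQ-involutive k b)
             (transposeQ-involutive k c) (transposeQ-involutive k d)

-- Quadtrees as list matrices

dim : ℕ → ℕ
dim zero    = 1
dim (suc k) = dim k +ℕ dim k

beside : Matrix → Matrix → Matrix
beside = zipWith _++_

⟦_⟧ : ∀ k → Q k → Matrix
⟦ zero  ⟧ x              = [ [ x ] ]
⟦ suc k ⟧ (quad a b c d) = block (⟦ k ⟧ a) (⟦ k ⟧ b) (⟦ k ⟧ c) (⟦ k ⟧ d)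

Width : ℕ → Matrix → Set
Width n = All (λ row → length row ≡ n)

length-zipWith-≡ : ∀ {A B C : Set} (f : A → B → C) {n} xs ys →
                   length xs ≡ n → length ys ≡ n → length (zipWith f xs ys) ≡ n
length-zipWith-≡ f {n} xs ys refl eq =
  trans (Listₚ.length-zipWith f xs ys) (trans (cong (length xs ⊓_) eq) (ℕₚ.⊓-idem n))

width-beside : ∀ {n m} A B → Width n A → Width m B → Width (n +ℕ m) (beside A B)
width-beside []      B       _        _        = []
width-beside (a ∷ A) []      _        _        = []
width-beside (a ∷ A) (b ∷ B) (p ∷ ps) (q ∷ qs) =
  trans (Listₚ.length-++ a) (cong₂ _+ℕ_ p q) ∷ width-beside A B ps qs

length-⟦⟧ : ∀ k x → length (⟦ k ⟧ x) ≡ dim k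
length-⟦⟧ zero    x              = refl
length-⟦⟧ (suc k) (quad a b c d) =
  trans (Listₚ.length-++ (beside (⟦ k ⟧ a) (⟦ k ⟧ b)))
        (cong₂ _+ℕ_ (length-zipWith-≡ _++_ (⟦ k ⟧ a) (⟦ k ⟧ b) (length-⟦⟧ k a) (length-⟦⟧ k b))
                    (length-zipWith-≡ _++_ (⟦ k ⟧ c) (⟦ k ⟧ d) (length-⟦⟧ k c) (length-⟦⟧ k d)))

width-⟦⟧ : ∀ k x → Width (dim k) (⟦ k ⟧ x)
width-⟦⟧ zero    x              = refl ∷ []
width-⟦⟧ (suc k) (quad a b c d) =
  ++⁺ (width-beside (⟦ k ⟧ a) (⟦ k ⟧ b) (width-⟦⟧ k a) (width-⟦⟧ k b))
      (width-beside (⟦ k ⟧ c) (⟦ k ⟧ d) (width-⟦⟧ k c) (width-⟦⟧ k d))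

zipWith-++ : ∀ {A B C : Set} (f : A → B → C) (xs xs′ : List A) (ys ys′ : List B) →
             length xs ≡ length ys → zipWith f (xs ++ xs′) (ys ++ ys′) ≡ zipWith f xs ys ++ zipWith f xs′ ys′
zipWith-++ f []       xs′ []       ys′ _  = refl
zipWith-++ f (x ∷ xs) xs′ (y ∷ ys) ys′ eq =
  cong (f x y ∷_) (zipWith-++ f xs xs′ ys ys′ (ℕₚ.suc-injective eq))

replicate-+ : ∀ {A : Set} n m (a : A) → replicate (n +ℕ m) a ≡ replicate n a ++ replicate m a
replicate-+ zero    m a = refl
replicate-+ (suc n) m a = cong (a ∷_) (replicate-+ n m a)

transposeʷ : ℕ → Matrix → Matrix
transposeʷ n = foldr (zipWith _∷_) (replicate n [])

transpose≡transposeʷ : ∀ {n} M → Width n M → 0 < length M → transpose M ≡ transposeʷ n M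
transpose≡transposeʷ (r ∷ M) (refl ∷ _) _ = refl

length-transposeʷ : ∀ n M → Width n M → length (transposeʷ n M) ≡ n
length-transposeʷ n []      _        = Listₚ.length-replicate n
length-transposeʷ n (r ∷ M) (p ∷ ps) = length-zipWith-≡ _∷_ r (transposeʷ n M) p (length-transposeʷ n M ps)

zipWith-∷-beside : ∀ (x : List ℤ) T Z → zipWith _∷_ x (beside T Z) ≡ beside (zipWith _∷_ x T) Z
zipWith-∷-beside []       T       Z       = refl
zipWith-∷-beside (x ∷ xs) []      Z       = refl
zipWith-∷-beside (x ∷ xs) (t ∷ T) []      = refl
zipWith-∷-beside (x ∷ xs) (t ∷ T) (z ∷ Z) = cong ((x ∷ t ++ z) ∷_) (zipWith-∷-beside xs T Z)

beside-replicate-[] : ∀ Z → beside (replicate (length Z) []) Z ≡ Z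
beside-replicate-[] []      = refl
beside-replicate-[] (z ∷ Z) = cong (z ∷_) (beside-replicate-[] Z)

foldr-zipWith-∷ : ∀ n X Z → Width n X → length Z ≡ n →
                  foldr (zipWith _∷_) Z X ≡ beside (transposeʷ n X) Z
foldr-zipWith-∷ n []      Z _        refl = sym (beside-replicate-[] Z)
foldr-zipWith-∷ n (x ∷ X) Z (p ∷ ps) eq   =
  trans (cong (zipWith _∷_ x) (foldr-zipWith-∷ n X Z ps eq)) (zipWith-∷-beside x (transposeʷ n X) Z)

transposeʷ-beside : ∀ n m A B → Width n A → Width m B → length A ≡ length B →
                    transposeʷ (n +ℕ m) (beside A B) ≡ transposeʷ n A ++ transposeʷ m B
transposeʷ-beside n m []      []      _        _        _  = replicate-+ n m []
transposeʷ-beside n m (a ∷ A) (b ∷ B) (p ∷ ps) (q ∷ qs) eq =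
  trans (cong (zipWith _∷_ (a ++ b)) (transposeʷ-beside n m A B ps qs (ℕₚ.suc-injective eq)))
        (zipWith-++ _∷_ a b (transposeʷ n A) (transposeʷ m B) (trans p (sym (length-transposeʷ n A ps))))

transposeʷ-block : ∀ n A B C D → Width n A → Width n B → Width n C → Width n D →
  length A ≡ n → length B ≡ n → length C ≡ n → length D ≡ n →
  transposeʷ (n +ℕ n) (block A B C D) ≡ block (transposeʷ n A) (transposeʷ n C) (transposeʷ n B) (transposeʷ n D)
transposeʷ-block n A B C D wA wB wC wD lA lB lC lD = begin
  transposeʷ (n +ℕ n) (beside A B ++ beside C D)
    ≡⟨ Listₚ.foldr-++ (zipWith _∷_) (replicate (n +ℕ n) []) (beside A B) (beside C D) ⟩
  foldr (zipWith _∷_) (transposeʷ (n +ℕ n) (beside C D)) (beside A B)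
    ≡⟨ foldr-zipWith-∷ (n +ℕ n) (beside A B) _ (width-beside A B wA wB)
                       (length-transposeʷ (n +ℕ n) (beside C D) (width-beside C D wC wD)) ⟩
  beside (transposeʷ (n +ℕ n) (beside A B)) (transposeʷ (n +ℕ n) (beside C D))
    ≡⟨ cong₂ beside (transposeʷ-beside n n A B wA wB (trans lA (sym lB)))
                    (transposeʷ-beside n n C D wC wD (trans lC (sym lD))) ⟩
  beside (transposeʷ n A ++ transposeʷ n B) (transposeʷ n C ++ transposeʷ n D)
    ≡⟨ zipWith-++ _++_ (transposeʷ n A) (transposeʷ n B) (transposeʷ n C) (transposeʷ n D)
                  (trans (length-transposeʷ n A wA) (sym (length-transposeʷ n C wC))) ⟩
  block (transposeʷ n A) (transposeʷ n C) (transposeʷ n B) (transposeʷ n D) ∎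
  where open ≡-Reasoning

transposeʷ-⟦⟧ : ∀ k x → transposeʷ (dim k) (⟦ k ⟧ x) ≡ ⟦ k ⟧ (transposeQ k x)
transposeʷ-⟦⟧ zero    x              = refl
transposeʷ-⟦⟧ (suc k) (quad a b c d) =
  trans (transposeʷ-block (dim k) (⟦ k ⟧ a) (⟦ k ⟧ b) (⟦ k ⟧ c) (⟦ k ⟧ d)
                          (width-⟦⟧ k a) (width-⟦⟧ k b) (width-⟦⟧ k c) (width-⟦⟧ k d)
                          (length-⟦⟧ k a) (length-⟦⟧ k b) (length-⟦⟧ k c) (length-⟦⟧ k d))
        (cong₄ block (transposeʷ-⟦⟧ k a) (transposeʷ-⟦⟧ k c) (transposeʷ-⟦⟧ k b) (transposeʷ-⟦⟧ k d))

0<dim : ∀ k → 0 < dim k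
0<dim zero    = ℕ.s≤s ℕ.z≤n
0<dim (suc k) = ℕₚ.<-≤-trans (0<dim k) (ℕₚ.m≤m+n (dim k) (dim k))

transpose-⟦⟧ : ∀ k x → transpose (⟦ k ⟧ x) ≡ ⟦ k ⟧ (transposeQ k x)
transpose-⟦⟧ k x =
  trans (transpose≡transposeʷ (⟦ k ⟧ x) (width-⟦⟧ k x) (subst (0 <_) (sym (length-⟦⟧ k x)) (0<dim k)))
        (transposeʷ-⟦⟧ k x)

_⊗ᵀ_ : Matrix → Matrix → Matrix
A ⊗ᵀ C = map (λ row → map (dot row) C) A

zipWithM : (ℤ → ℤ → ℤ) → Matrix → Matrix → Matrix
zipWithM f = zipWith (zipWith f)

⊗ᵀ-++ : ∀ X Y Y′ → X ⊗ᵀ (Y ++ Y′) ≡ beside (X ⊗ᵀ Y) (X ⊗ᵀ Y′)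
⊗ᵀ-++ []      Y Y′ = refl
⊗ᵀ-++ (r ∷ X) Y Y′ = cong₂ _∷_ (Listₚ.map-++ (dot r) Y Y′) (⊗ᵀ-++ X Y Y′)

dot-++ : ∀ (u u′ v v′ : List ℤ) → length u ≡ length v → dot (u ++ u′) (v ++ v′) ≡ dot u v + dot u′ v′
dot-++ []      u′ []      v′ _  = sym (ℤₚ.+-identityˡ (dot u′ v′))
dot-++ (x ∷ u) u′ (y ∷ v) v′ eq =
  trans (cong (λ z → x * y + z) (dot-++ u u′ v v′ (ℕₚ.suc-injective eq)))
        (sym (ℤₚ.+-assoc (x * y) (dot u v) (dot u′ v′)))

map-dot-++ : ∀ (u u′ : List ℤ) E F → Width (length u) E →
             map (dot (u ++ u′)) (beside E F) ≡ zipWith _+_ (map (dot u) E) (map (dot u′) F)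
map-dot-++ u u′ []      F       _        = refl
map-dot-++ u u′ (e ∷ E) []      _        = refl
map-dot-++ u u′ (e ∷ E) (f ∷ F) (p ∷ ps) = cong₂ _∷_ (dot-++ u u′ e f (sym p)) (map-dot-++ u u′ E F ps)

beside-⊗ᵀ-beside : ∀ {n} A B E F → Width n A → Width n E →
                   beside A B ⊗ᵀ beside E F ≡ zipWithM _+_ (A ⊗ᵀ E) (B ⊗ᵀ F)
beside-⊗ᵀ-beside []      B       E F _           _  = refl
beside-⊗ᵀ-beside (a ∷ A) []      E F _           _  = refl
beside-⊗ᵀ-beside (a ∷ A) (b ∷ B) E F (refl ∷ ps) wE =
  cong₂ _∷_ (map-dot-++ a b E F wE) (beside-⊗ᵀ-beside A B E F ps wE)

zipWithM-beside : ∀ {n} f A B E F → Width n A → Width n E →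
                  zipWithM f (beside A B) (beside E F) ≡ beside (zipWithM f A E) (zipWithM f B F)
zipWithM-beside f []      B       E       F       _        _        = refl
zipWithM-beside f (a ∷ A) []      []      F       _        _        = refl
zipWithM-beside f (a ∷ A) []      (e ∷ E) []      _        _        = refl
zipWithM-beside f (a ∷ A) []      (e ∷ E) (x ∷ F) _        _        = refl
zipWithM-beside f (a ∷ A) (b ∷ B) []      F       _        _        = refl
zipWithM-beside f (a ∷ A) (b ∷ B) (e ∷ E) []      _        _        = refl
zipWithM-beside f (a ∷ A) (b ∷ B) (e ∷ E) (x ∷ F) (p ∷ ps) (q ∷ qs) =
  cong₂ _∷_ (zipWith-++ f a b e x (trans p (sym q))) (zipWithM-beside f A B E F ps qs)

zipWithM-⟦⟧ : ∀ k f x y → zipWithM f (⟦ k ⟧ x) (⟦ k ⟧ y) ≡ ⟦ k ⟧ (zipWithQ k f x y)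
zipWithM-⟦⟧ zero    f x              y              = refl
zipWithM-⟦⟧ (suc k) f (quad a b c d) (quad e g h i) =
  trans (zipWith-++ (zipWith f) (beside (⟦ k ⟧ a) (⟦ k ⟧ b)) (beside (⟦ k ⟧ c) (⟦ k ⟧ d))
                                (beside (⟦ k ⟧ e) (⟦ k ⟧ g)) (beside (⟦ k ⟧ h) (⟦ k ⟧ i))
                    (trans (length-beside a b) (sym (length-beside e g))))
        (cong₂ _++_ (half a b e g) (half c d h i))
  where
  length-beside : ∀ a b → length (beside (⟦ k ⟧ a) (⟦ k ⟧ b)) ≡ dim k
  length-beside a b = length-zipWith-≡ _++_ (⟦ k ⟧ a) (⟦ k ⟧ b) (length-⟦⟧ k a) (length-⟦⟧ k b)
  half : ∀ a b e g → zipWithM f (beside (⟦ k ⟧ a) (⟦ k ⟧ b)) (beside (⟦ k ⟧ e) (⟦ k ⟧ g))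
                     ≡ beside (⟦ k ⟧ (zipWithQ k f a e)) (⟦ k ⟧ (zipWithQ k f b g))
  half a b e g =
    trans (zipWithM-beside f (⟦ k ⟧ a) (⟦ k ⟧ b) (⟦ k ⟧ e) (⟦ k ⟧ g) (width-⟦⟧ k a) (width-⟦⟧ k e))
          (cong₂ beside (zipWithM-⟦⟧ k f a e) (zipWithM-⟦⟧ k f b g))

map-beside : ∀ (f : ℤ → ℤ) A B → map (map f) (beside A B) ≡ beside (map (map f) A) (map (map f) B)
map-beside f []      B       = refl
map-beside f (a ∷ A) []      = refl
map-beside f (a ∷ A) (b ∷ B) = cong₂ _∷_ (Listₚ.map-++ f a b) (map-beside f A B)

map-⟦⟧ : ∀ k (f : ℤ → ℤ) x → map (map f) (⟦ k ⟧ x) ≡ ⟦ k ⟧ (mapQ k f x)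
map-⟦⟧ zero    f x              = refl
map-⟦⟧ (suc k) f (quad a b c d) =
  trans (Listₚ.map-++ (map f) (beside (⟦ k ⟧ a) (⟦ k ⟧ b)) (beside (⟦ k ⟧ c) (⟦ k ⟧ d)))
        (cong₂ _++_ (half a b) (half c d))
  where
  half : ∀ a b → map (map f) (beside (⟦ k ⟧ a) (⟦ k ⟧ b))
                 ≡ beside (⟦ k ⟧ (mapQ k f a)) (⟦ k ⟧ (mapQ k f b))
  half a b = trans (map-beside f (⟦ k ⟧ a) (⟦ k ⟧ b)) (cong₂ beside (map-⟦⟧ k f a) (map-⟦⟧ k f b))

⊗ᵀ-⟦⟧ : ∀ k x y → ⟦ k ⟧ x ⊗ᵀ ⟦ k ⟧ y ≡ ⟦ k ⟧ (mulQ k x (transposeQ k y))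
⊗ᵀ-⟦⟧ zero    x              y              = cong (λ z → [ [ z ] ]) (ℤₚ.+-identityʳ (x * y))
⊗ᵀ-⟦⟧ (suc k) (quad a b c d) (quad e f g h) =
  trans (Listₚ.map-++ _ (beside (⟦ k ⟧ a) (⟦ k ⟧ b)) (beside (⟦ k ⟧ c) (⟦ k ⟧ d)))
        (cong₂ _++_ (half a b) (half c d))
  where
  entry : ∀ a b e f → beside (⟦ k ⟧ a) (⟦ k ⟧ b) ⊗ᵀ beside (⟦ k ⟧ e) (⟦ k ⟧ f)
                      ≡ ⟦ k ⟧ (addQ k (mulQ k a (transposeQ k e)) (mulQ k b (transposeQ k f)))
  entry a b e f =
    trans (beside-⊗ᵀ-beside (⟦ k ⟧ a) (⟦ k ⟧ b) (⟦ k ⟧ e) (⟦ k ⟧ f)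
                            (width-⟦⟧ k a) (width-⟦⟧ k e))
          (trans (cong₂ (zipWithM _+_) (⊗ᵀ-⟦⟧ k a e) (⊗ᵀ-⟦⟧ k b f)) (zipWithM-⟦⟧ k _+_ _ _))
  half : ∀ a b → beside (⟦ k ⟧ a) (⟦ k ⟧ b) ⊗ᵀ ⟦ suc k ⟧ (quad e f g h)
                ≡ beside (⟦ k ⟧ (addQ k (mulQ k a (transposeQ k e)) (mulQ k b (transposeQ k f))))
                         (⟦ k ⟧ (addQ k (mulQ k a (transposeQ k g)) (mulQ k b (transposeQ k h))))
  half a b = trans (⊗ᵀ-++ _ (beside (⟦ k ⟧ e) (⟦ k ⟧ f)) (beside (⟦ k ⟧ g) (⟦ k ⟧ h)))
                   (cong₂ beside (entry a b e f) (entry a b g h))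

⊗-⟦⟧ : ∀ k x y → ⟦ k ⟧ x ⊗ ⟦ k ⟧ y ≡ ⟦ k ⟧ (mulQ k x y)
⊗-⟦⟧ k x y = begin
  ⟦ k ⟧ x ⊗ᵀ transpose (⟦ k ⟧ y)
    ≡⟨ cong (⟦ k ⟧ x ⊗ᵀ_) (transpose-⟦⟧ k y) ⟩
  ⟦ k ⟧ x ⊗ᵀ ⟦ k ⟧ (transposeQ k y)
    ≡⟨ ⊗ᵀ-⟦⟧ k x (transposeQ k y) ⟩
  ⟦ k ⟧ (mulQ k x (transposeQ k (transposeQ k y)))
    ≡⟨ cong (λ z → ⟦ k ⟧ (mulQ k x z)) (transposeQ-involutive k y) ⟩
  ⟦ k ⟧ (mulQ k x y) ∎
  where open ≡-Reasoning

diagQ : ∀ k → List ℤ → Q k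
diagQ zero    []      = + 0
diagQ zero    (x ∷ _) = x
diagQ (suc k) l       = quad (diagQ k (take (dim k) l)) (zeroQ k) (zeroQ k) (diagQ k (drop (dim k) l))

zeros : ℕ → ℕ → Matrix
zeros n m = replicate n (replicate m (+ 0))

zeroQ-⟦⟧ : ∀ k → ⟦ k ⟧ (zeroQ k) ≡ zeros (dim k) (dim k)
zeroQ-⟦⟧ zero    = refl
zeroQ-⟦⟧ (suc k) = begin
  beside (⟦ k ⟧ (zeroQ k)) (⟦ k ⟧ (zeroQ k)) ++ beside (⟦ k ⟧ (zeroQ k)) (⟦ k ⟧ (zeroQ k))
    ≡⟨ cong (λ Z → beside Z Z ++ beside Z Z) (zeroQ-⟦⟧ k) ⟩
  beside (zeros n n) (zeros n n) ++ beside (zeros n n) (zeros n n)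
    ≡⟨ cong (λ Z → Z ++ Z) (Listₚ.zipWith-replicate n _++_ (replicate n (+ 0)) (replicate n (+ 0))) ⟩
  replicate n row ++ replicate n row
    ≡⟨ replicate-+ n n row ⟨
  replicate (n +ℕ n) row
    ≡⟨ cong (replicate (n +ℕ n)) (replicate-+ n n (+ 0)) ⟨
  zeros (n +ℕ n) (n +ℕ n) ∎
  where
  open ≡-Reasoning
  n = dim k
  row = replicate n (+ 0) ++ replicate n (+ 0)

length-diag : ∀ l → length (diag l) ≡ length l
length-diag []      = refl
length-diag (x ∷ l) = cong suc (trans (Listₚ.length-map (+ 0 ∷_) (diag l)) (length-diag l))

map-∷-beside : ∀ (a : ℤ) X Y → map (a ∷_) (beside X Y) ≡ beside (map (a ∷_) X) Y
map-∷-beside a []      Y       = refl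
map-∷-beside a (x ∷ X) []      = refl
map-∷-beside a (x ∷ X) (y ∷ Y) = cong ((a ∷ x ++ y) ∷_) (map-∷-beside a X Y)

diag-++ : ∀ u v → diag (u ++ v) ≡ block (diag u) (zeros (length u) (length v)) (zeros (length v) (length u)) (diag v)
diag-++ []      v = sym (trans (cong (λ n → beside (replicate n []) (diag v)) (sym (length-diag v)))
                               (beside-replicate-[] (diag v)))
diag-++ (x ∷ u) v = cong₂ _∷_
  (cong (x ∷_) (trans (cong (λ n → replicate n (+ 0)) (Listₚ.length-++ u)) (replicate-+ (length u) (length v) (+ 0))))
  (begin
    map (+ 0 ∷_) (diag (u ++ v))
      ≡⟨ cong (map (+ 0 ∷_)) (diag-++ u v) ⟩
    map (+ 0 ∷_) (beside (diag u) Z ++ beside Z′ (diag v))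
      ≡⟨ Listₚ.map-++ (+ 0 ∷_) (beside (diag u) Z) (beside Z′ (diag v)) ⟩
    map (+ 0 ∷_) (beside (diag u) Z) ++ map (+ 0 ∷_) (beside Z′ (diag v))
      ≡⟨ cong₂ _++_ (map-∷-beside (+ 0) (diag u) Z) (map-∷-beside (+ 0) Z′ (diag v)) ⟩
    beside (map (+ 0 ∷_) (diag u)) Z ++ beside (map (+ 0 ∷_) Z′) (diag v)
      ≡⟨ cong (λ M → beside (map (+ 0 ∷_) (diag u)) Z ++ beside M (diag v))
              (Listₚ.map-replicate (+ 0 ∷_) (length v) (replicate (length u) (+ 0))) ⟩
    beside (map (+ 0 ∷_) (diag u)) Z ++ beside (zeros (length v) (suc (length u))) (diag v) ∎)
  where
  open ≡-Reasoning
  Z  = zeros (length u) (length v)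
  Z′ = zeros (length v) (length u)

length-take-drop : ∀ n m (l : List ℤ) → length l ≡ n +ℕ m → length (take n l) ≡ n × length (drop n l) ≡ m
length-take-drop zero    m l       eq = refl , eq
length-take-drop (suc n) m (x ∷ l) eq =
  let (t , d) = length-take-drop n m l (ℕₚ.suc-injective eq) in cong suc t , d

diag-⟦⟧ : ∀ k l → length l ≡ dim k → diag l ≡ ⟦ k ⟧ (diagQ k l)
diag-⟦⟧ zero    (x ∷ []) _  = refl
diag-⟦⟧ (suc k) l        eq = begin
  diag l
    ≡⟨ cong diag (Listₚ.take++drop≡id n l) ⟨
  diag (take n l ++ drop n l)
    ≡⟨ diag-++ (take n l) (drop n l) ⟩
  block (diag (take n l)) (zeros (length (take n l)) (length (drop n l)))
        (zeros (length (drop n l)) (length (take n l))) (diag (drop n l))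
    ≡⟨ cong₄ block (diag-⟦⟧ k (take n l) t) (cong₂ zeros t d)
                   (cong₂ zeros d t) (diag-⟦⟧ k (drop n l) d) ⟩
  block (⟦ k ⟧ (diagQ k (take n l))) (zeros n n) (zeros n n) (⟦ k ⟧ (diagQ k (drop n l)))
    ≡⟨ cong (λ Z → block (⟦ k ⟧ (diagQ k (take n l))) Z Z (⟦ k ⟧ (diagQ k (drop n l)))) (zeroQ-⟦⟧ k) ⟨
  ⟦ suc k ⟧ (diagQ (suc k) l) ∎
  where
  open ≡-Reasoning
  n = dim k
  t = proj₁ (length-take-drop n n l eq)
  d = proj₂ (length-take-drop n n l eq)

take-++-length : ∀ {A : Set} (u v : List A) → take (length u) (u ++ v) ≡ u
take-++-length []      v = refl
take-++-length (x ∷ u) v = cong (x ∷_) (take-++-length u v)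

drop-++-length : ∀ {A : Set} (u v : List A) → drop (length u) (u ++ v) ≡ v
drop-++-length []      v = refl
drop-++-length (x ∷ u) v = drop-++-length u v

take-zipWith : ∀ {A B C : Set} (f : A → B → C) n xs ys →
               take n (zipWith f xs ys) ≡ zipWith f (take n xs) (take n ys)
take-zipWith f zero    xs       ys       = refl
take-zipWith f (suc n) []       ys       = refl
take-zipWith f (suc n) (x ∷ xs) []       = refl
take-zipWith f (suc n) (x ∷ xs) (y ∷ ys) = cong (f x y ∷_) (take-zipWith f n xs ys)

drop-zipWith : ∀ {A B C : Set} (f : A → B → C) n xs ys →
               drop n (zipWith f xs ys) ≡ zipWith f (drop n xs) (drop n ys)
drop-zipWith f zero    xs       ys       = refl
drop-zipWith f (suc n) []       ys       = sym (Listₚ.zipWith-zeroˡ f (drop n ys))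
drop-zipWith f (suc n) (x ∷ xs) []       = sym (Listₚ.zipWith-zeroʳ f (drop n xs))
drop-zipWith f (suc n) (x ∷ xs) (y ∷ ys) = drop-zipWith f n xs ys

diagQ-++ : ∀ k u v → length u ≡ dim k → diagQ (suc k) (u ++ v) ≡ quad (diagQ k u) (zeroQ k) (zeroQ k) (diagQ k v)
diagQ-++ k u v eq rewrite sym eq = cong₂ (λ x y → quad (diagQ k x) (zeroQ k) (zeroQ k) (diagQ k y))
                            (take-++-length u v) (drop-++-length u v)

zipWithQ-zeroQ : ∀ k f → f (+ 0) (+ 0) ≡ + 0 → zipWithQ k f (zeroQ k) (zeroQ k) ≡ zeroQ k
zipWithQ-zeroQ zero    f f00 = f00
zipWithQ-zeroQ (suc k) f f00 = cong₄ quad (zipWithQ-zeroQ k f f00) (zipWithQ-zeroQ k f f00)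
                                          (zipWithQ-zeroQ k f f00) (zipWithQ-zeroQ k f f00)

diagQ-zipWith : ∀ k f → f (+ 0) (+ 0) ≡ + 0 → ∀ u v → length u ≡ length v →
                diagQ k (zipWith f u v) ≡ zipWithQ k f (diagQ k u) (diagQ k v)
diagQ-zipWith zero    f f00 []      []      _  = sym f00
diagQ-zipWith zero    f f00 (x ∷ u) (y ∷ v) _  = refl
diagQ-zipWith (suc k) f f00 u       v       eq =
  cong₄ quad
    (trans (cong (diagQ k) (take-zipWith f n u v))
           (diagQ-zipWith k f f00 (take n u) (take n v)
             (trans (Listₚ.length-take n u) (trans (cong (n ⊓_) eq) (sym (Listₚ.length-take n v))))))
    (sym (zipWithQ-zeroQ k f f00)) (sym (zipWithQ-zeroQ k f f00))
    (trans (cong (diagQ k) (drop-zipWith f n u v))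
           (diagQ-zipWith k f f00 (drop n u) (drop n v)
             (trans (Listₚ.length-drop n u) (trans (cong (_∸ n) eq) (sym (Listₚ.length-drop n v))))))
  where n = dim k

-- The matrices H_k, φ^k(1), φ^k(0) and their conjugation

hadamardQ : ∀ k → Q k
hadamardQ zero    = + 1
hadamardQ (suc k) = quad (hadamardQ k) (hadamardQ k) (hadamardQ k) (negQ k (hadamardQ k))

φ1Q φ0Q : ∀ k → Q k
φ1Q zero    = + 1
φ1Q (suc k) = quad (φ1Q k) (φ0Q k) (φ0Q k) (φ1Q k)
φ0Q zero    = + 0
φ0Q (suc k) = quad (φ1Q k) (φ1Q k) (φ1Q k) (φ1Q k)

H-⟦⟧ : ∀ k → H k ≡ ⟦ k ⟧ (hadamardQ k)
H-⟦⟧ zero    = refl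
H-⟦⟧ (suc k) rewrite H-⟦⟧ k = cong (block h h h) (map-⟦⟧ k (λ x → - x) (hadamardQ k))
  where h = ⟦ k ⟧ (hadamardQ k)

φ-⟦⟧ : ∀ k → φ1 k ≡ ⟦ k ⟧ (φ1Q k) × φ0 k ≡ ⟦ k ⟧ (φ0Q k)
φ-⟦⟧ zero = refl , refl
φ-⟦⟧ (suc k) with φ-⟦⟧ k
... | eq₁ , eq₀ rewrite eq₁ | eq₀ = refl , refl

conjQ : ∀ k → Q k → Q k → Q k
conjQ k h p = mulQ k (mulQ k h p) h

twiceSum twiceDifference : ℤ → ℤ → ℤ
twiceSum        a b = + 2 * (a + b)
twiceDifference a b = + 2 * (a - b)

conjQ-hadamard-block : ∀ k h p q →
  conjQ (suc k) (quad h h h (negQ k h)) (quad p q q p)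
    ≡ quad (zipWithQ k twiceSum (conjQ k h p) (conjQ k h q)) (zeroQ k)
           (zeroQ k) (zipWithQ k twiceDifference (conjQ k h p) (conjQ k h q))
conjQ-hadamard-block k h p q =
  cong₄ quad
    (trans (cong₂ (addQ k) (sum p q) (sum q p))
           (entry ((‵x ‵+ ‵y) ‵+ (‵y ‵+ ‵x)) (‵op₂ twiceSum ‵x ‵y) upper-left))
    (trans (cong₂ (addQ k) (sum p q) (negated (sum q p)))
           (entry ((‵x ‵+ ‵y) ‵+ ‵- (‵y ‵+ ‵x)) ‵0 upper-right))
    (trans (cong₂ (addQ k) (difference p q) (difference q p))
           (entry ((‵x ‵+ ‵- ‵y) ‵+ (‵y ‵+ ‵- ‵x)) ‵0 lower-left))
    (trans (cong₂ (addQ k) (difference p q) (negated (difference q p)))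
           (entry ((‵x ‵+ ‵- ‵y) ‵+ ‵- (‵y ‵+ ‵- ‵x)) (‵op₂ twiceDifference ‵x ‵y) lower-right))
  where
  A = conjQ k h p
  B = conjQ k h q
  upper-left  : ∀ a b → (a + b) + (b + a) ≡ + 2 * (a + b)
  upper-left  = solve-∀
  upper-right : ∀ a b → (a + b) + - (b + a) ≡ + 0
  upper-right = solve-∀
  lower-left  : ∀ a b → (a + - b) + (b + - a) ≡ + 0
  lower-left  = solve-∀
  lower-right : ∀ a b → (a + - b) + - (b + - a) ≡ + 2 * (a - b)
  lower-right = solve-∀
  entry : ∀ e e′ → (∀ x y → evalℤ e x y ≡ evalℤ e′ x y) → evalQ k e A B ≡ evalQ k e′ A B
  entry e e′ eq = entrywise-identity k e e′ eq A B
  sum : ∀ p q → mulQ k (addQ k (mulQ k h p) (mulQ k h q)) h ≡ addQ k (conjQ k h p) (conjQ k h q)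
  sum p q = mulQ-distribʳ-addQ k (mulQ k h p) (mulQ k h q) h
  difference : ∀ p q → mulQ k (addQ k (mulQ k h p) (mulQ k (negQ k h) q)) h
                       ≡ addQ k (conjQ k h p) (negQ k (conjQ k h q))
  difference p q = trans (mulQ-distribʳ-addQ k (mulQ k h p) (mulQ k (negQ k h) q) h)
                         (cong (addQ k (conjQ k h p))
                               (trans (cong (λ x → mulQ k x h) (mulQ-negQˡ k h q)) (mulQ-negQˡ k (mulQ k h q) h)))
  negated : ∀ {x y} → mulQ k x h ≡ y → mulQ k x (negQ k h) ≡ negQ k y
  negated {x} eq = trans (mulQ-negQʳ k x h) (cong (negQ k) eq)

-- Jacobsthal numbers and the vectors ρ^m(1)

jacobsthal : ℕ → ℕ
jacobsthal zero          = 0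
jacobsthal (suc zero)    = 1
jacobsthal (suc (suc n)) = jacobsthal (suc n) +ℕ (jacobsthal n +ℕ jacobsthal n)

sign : ℕ → ℤ
sign n = (- + 1) ^ n

three-jacobsthal : ∀ n → (+ 2) ^ n - sign n ≡ + jacobsthal n * + 3
                       × (+ 2) ^ suc n - sign (suc n) ≡ + jacobsthal (suc n) * + 3
three-jacobsthal zero    = refl , refl
three-jacobsthal (suc n) with three-jacobsthal n
... | eq₀ , eq₁ = eq₁ , (begin
  + 2 * (+ 2 * p) - - + 1 * (- + 1 * s)       ≡⟨ step p s ⟩
  (+ 2 * p - - + 1 * s) + ((p - s) + (p - s)) ≡⟨ cong₂ (λ a b → a + (b + b)) eq₁ eq₀ ⟩
  + j₁ * + 3 + (+ j₀ * + 3 + + j₀ * + 3)      ≡⟨ collect (+ j₀) (+ j₁) ⟩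
  (+ j₁ + (+ j₀ + + j₀)) * + 3                ≡⟨⟩
  + jacobsthal (suc (suc n)) * + 3            ∎)
  where
  open ≡-Reasoning
  p = (+ 2) ^ n
  s = sign n
  j₀ = jacobsthal n
  j₁ = jacobsthal (suc n)
  step : ∀ p s → + 2 * (+ 2 * p) - - + 1 * (- + 1 * s) ≡ (+ 2 * p - - + 1 * s) + ((p - s) + (p - s))
  step = solve-∀
  collect : ∀ a b → b * + 3 + (a * + 3 + a * + 3) ≡ (b + (a + a)) * + 3
  collect = solve-∀

J≡jacobsthal : ∀ n → J n ≡ + jacobsthal n
J≡jacobsthal n = trans (cong (_/ℕ 3) (trans (proj₁ (three-jacobsthal n)) (sym (ℤₚ.pos-* (jacobsthal n) 3))))
                       (cong +_ (m*n/n≡m (jacobsthal n) 3))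

J-recurrence : ∀ n → J (suc (suc n)) ≡ J (suc n) + + 2 * J n
J-recurrence n rewrite J≡jacobsthal (suc (suc n)) | J≡jacobsthal (suc n) | J≡jacobsthal n =
  double (+ jacobsthal (suc n)) (+ jacobsthal n)
  where
  double : ∀ a b → a + (b + b) ≡ a + + 2 * b
  double = solve-∀

J-alternating : ∀ n → J (suc n) - + 2 * J n ≡ sign n
J-alternating zero    = refl
J-alternating (suc n) rewrite J-recurrence n =
  trans (regroup (J (suc n)) (J n)) (cong (- + 1 *_) (J-alternating n))
  where
  regroup : ∀ a b → (a + + 2 * b) - + 2 * a ≡ - + 1 * (a - + 2 * b)
  regroup = solve-∀

concatMap-ρ-neg : ∀ v → concatMap ρ (map (λ x → - x) v) ≡ map (λ x → - x) (concatMap ρ v)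
concatMap-ρ-neg []      = refl
concatMap-ρ-neg (x ∷ v) = cong (λ t → - - x ∷ - x ∷ t) (concatMap-ρ-neg v)

ρpow-suc : ∀ m → ρpow (suc m) ≡ map (λ x → - x) (ρpow m) ++ ρpow m
ρpow-suc zero    = refl
ρpow-suc (suc m) = begin
  concatMap ρ (ρpow (suc m))
    ≡⟨ cong (concatMap ρ) (ρpow-suc m) ⟩
  concatMap ρ (map (λ x → - x) (ρpow m) ++ ρpow m)
    ≡⟨ Listₚ.concatMap-++ ρ (map (λ x → - x) (ρpow m)) (ρpow m) ⟩
  concatMap ρ (map (λ x → - x) (ρpow m)) ++ ρpow (suc m)
    ≡⟨ cong (_++ ρpow (suc m)) (concatMap-ρ-neg (ρpow m)) ⟩
  map (λ x → - x) (ρpow (suc m)) ++ ρpow (suc m) ∎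
  where open ≡-Reasoning

length-ρpow : ∀ m → length (ρpow m) ≡ dim m
length-ρpow zero    = refl
length-ρpow (suc m) = begin
  length (ρpow (suc m))
    ≡⟨ cong length (ρpow-suc m) ⟩
  length (map (λ x → - x) (ρpow m) ++ ρpow m)
    ≡⟨ Listₚ.length-++ (map (λ x → - x) (ρpow m)) ⟩
  length (map (λ x → - x) (ρpow m)) +ℕ length (ρpow m)
    ≡⟨ cong (_+ℕ length (ρpow m)) (Listₚ.length-map _ (ρpow m)) ⟩
  length (ρpow m) +ℕ length (ρpow m)
    ≡⟨ cong (λ n → n +ℕ n) (length-ρpow m) ⟩
  dim (suc m) ∎
  where open ≡-Reasoning

ρBlocks : (ℕ → ℤ) → List ℕ → List ℤ
ρBlocks c = concatMap (λ m → scaleV (c m) (ρpow m))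

ρBlocks-cong : ∀ {P : ℕ → Set} c d → (∀ m → P m → c m ≡ d m) →
               ∀ {ms} → All P ms → ρBlocks c ms ≡ ρBlocks d ms
ρBlocks-cong c d eq []                  = refl
ρBlocks-cong c d eq (_∷_ {m} pm pms) = cong₂ (λ a t → scaleV a (ρpow m) ++ t) (eq m pm) (ρBlocks-cong c d eq pms)

zipWith-scaleV : ∀ (g : ℤ → ℤ → ℤ) → (∀ a b x → g (a * x) (b * x) ≡ g a b * x) →
                 ∀ a b v → zipWith g (scaleV a v) (scaleV b v) ≡ scaleV (g a b) v
zipWith-scaleV g linear a b []      = refl
zipWith-scaleV g linear a b (x ∷ v) = cong₂ _∷_ (linear a b x) (zipWith-scaleV g linear a b v)

ρBlocks-zipWith : ∀ (g : ℤ → ℤ → ℤ) → (∀ a b x → g (a * x) (b * x) ≡ g a b * x) →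
                  ∀ c d ms → zipWith g (ρBlocks c ms) (ρBlocks d ms) ≡ ρBlocks (λ m → g (c m) (d m)) ms
ρBlocks-zipWith g linear c d []       = refl
ρBlocks-zipWith g linear c d (m ∷ ms) =
  trans (zipWith-++ g (scaleV (c m) (ρpow m)) (ρBlocks c ms) (scaleV (d m) (ρpow m)) (ρBlocks d ms)
                    (trans (Listₚ.length-map _ (ρpow m)) (sym (Listₚ.length-map _ (ρpow m)))))
        (cong₂ _++_ (zipWith-scaleV g linear (c m) (d m) (ρpow m)) (ρBlocks-zipWith g linear c d ms))

ρBlocks-neg : ∀ c ms → map (λ x → - x) (ρBlocks c ms) ≡ ρBlocks (λ m → - c m) ms
ρBlocks-neg c []       = refl
ρBlocks-neg c (m ∷ ms) =
  trans (Listₚ.map-++ (λ x → - x) (scaleV (c m) (ρpow m)) (ρBlocks c ms))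
        (cong₂ _++_ (trans (sym (Listₚ.map-∘ (ρpow m))) (Listₚ.map-cong (ℤₚ.neg-distribˡ-* (c m)) (ρpow m)))
                    (ρBlocks-neg c ms))

ρBlocks-snoc : ∀ c ms m → ρBlocks c (ms ++ [ m ]) ≡ ρBlocks c ms ++ scaleV (c m) (ρpow m)
ρBlocks-snoc c ms m = trans (Listₚ.concatMap-++ _ ms [ m ]) (cong (ρBlocks c ms ++_) (Listₚ.++-identityʳ _))

range1-suc : ∀ k → range1 (suc (suc k)) ≡ range1 (suc k) ++ [ suc k ]
range1-suc k = cong (drop 1) (sym (Listₚ.upTo-∷ʳ (suc k)))

range1-< : ∀ k → All (_< k) (range1 k)
range1-< k = drop⁺ 1 (all-upTo k)

scaleV-one : ∀ v → scaleV (+ 1) v ≡ v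
scaleV-one v = trans (Listₚ.map-cong ℤₚ.*-identityˡ v) (Listₚ.map-id v)

suc-∸ : ∀ {k m} → m ≤ k → suc k ∸ m ≡ suc (k ∸ m)
suc-∸ = ℕₚ.+-∸-assoc 1

ρpow-as-blocks : ∀ k → ρpow (suc k) ≡ sign (suc k) ∷ sign k ∷ ρBlocks (λ m → sign (k ∸ m)) (range1 (suc k))
ρpow-as-blocks zero    = refl
ρpow-as-blocks (suc k) =
  trans (ρpow-suc (suc k))
    (trans (cong (λ v → map (λ x → - x) v ++ ρpow (suc k)) (ρpow-as-blocks k))
           (cong₂ _∷_ (negate (sign (suc k))) (cong₂ _∷_ (negate (sign k)) tail)))
  where
  open ≡-Reasoning
  negate : ∀ a → - a ≡ - + 1 * a
  negate a = sym (ℤₚ.-1*i≡-i a)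
  shift : ∀ m → m < suc k → - sign (k ∸ m) ≡ sign (suc k ∸ m)
  shift m m<1+k = trans (negate (sign (k ∸ m))) (cong sign (sym (suc-∸ (ℕₚ.≤-pred m<1+k))))
  tail : map (λ x → - x) (ρBlocks (λ m → sign (k ∸ m)) (range1 (suc k))) ++ ρpow (suc k)
         ≡ ρBlocks (λ m → sign (suc k ∸ m)) (range1 (suc (suc k)))
  tail = begin
    map (λ x → - x) (ρBlocks (λ m → sign (k ∸ m)) (range1 (suc k))) ++ ρpow (suc k)
      ≡⟨ cong₂ _++_ (ρBlocks-neg (λ m → sign (k ∸ m)) (range1 (suc k))) (sym (scaleV-one (ρpow (suc k)))) ⟩
    ρBlocks (λ m → - sign (k ∸ m)) (range1 (suc k)) ++ scaleV (+ 1) (ρpow (suc k))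
      ≡⟨ cong₂ _++_ (ρBlocks-cong (λ m → - sign (k ∸ m)) (λ m → sign (suc k ∸ m)) shift (range1-< (suc k)))
                    (cong (λ n → scaleV (sign n) (ρpow (suc k))) (sym (ℕₚ.n∸n≡0 k))) ⟩
    ρBlocks (λ m → sign (suc k ∸ m)) (range1 (suc k)) ++ scaleV (sign (suc k ∸ suc k)) (ρpow (suc k))
      ≡⟨ ρBlocks-snoc (λ m → sign (suc k ∸ m)) (range1 (suc k)) (suc k) ⟨
    ρBlocks (λ m → sign (suc k ∸ m)) (range1 (suc k) ++ [ suc k ])
      ≡⟨ cong (ρBlocks (λ m → sign (suc k ∸ m))) (range1-suc k) ⟨
    ρBlocks (λ m → sign (suc k ∸ m)) (range1 (suc (suc k))) ∎

-- The recursion satisfied by the diagonals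

addTwice subTwice : ℤ → ℤ → ℤ
addTwice x y = x + + 2 * y
subTwice x y = x - + 2 * y

addTwice-linear : ∀ a b x → a * x + + 2 * (b * x) ≡ (a + + 2 * b) * x
addTwice-linear = solve-∀

subTwice-linear : ∀ a b x → a * x - + 2 * (b * x) ≡ (a - + 2 * b) * x
subTwice-linear = solve-∀

zipWith-ρBlocks-range1 : ∀ g → (∀ a b x → g (a * x) (b * x) ≡ g a b * x) → ∀ k c d e →
  (∀ m → m < k → g (c m) (d m) ≡ e m) →
  zipWith g (ρBlocks c (range1 k)) (ρBlocks d (range1 k)) ≡ ρBlocks e (range1 k)
zipWith-ρBlocks-range1 g linear k c d e eq =
  trans (ρBlocks-zipWith g linear c d (range1 k)) (ρBlocks-cong (λ m → g (c m) (d m)) e eq (range1-< k))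

J-blocks-addTwice : ∀ k → zipWith addTwice (ρBlocks (λ m → J (suc k ∸ m)) (range1 (suc k)))
                                           (ρBlocks (λ m → J (k ∸ m)) (range1 (suc k)))
                          ≡ ρBlocks (λ m → J (suc (suc k) ∸ m)) (range1 (suc k))
J-blocks-addTwice k =
  zipWith-ρBlocks-range1 addTwice addTwice-linear (suc k)
    (λ m → J (suc k ∸ m)) (λ m → J (k ∸ m)) (λ m → J (suc (suc k) ∸ m)) entry
  where
  entry : ∀ m → m < suc k → addTwice (J (suc k ∸ m)) (J (k ∸ m)) ≡ J (suc (suc k) ∸ m)
  entry m m<1+k rewrite suc-∸ {suc k} {m} (ℕₚ.<⇒≤ m<1+k) | suc-∸ {k} {m} (ℕₚ.≤-pred m<1+k) =
    sym (J-recurrence (k ∸ m))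

J-blocks-subTwice : ∀ k → zipWith subTwice (ρBlocks (λ m → J (suc k ∸ m)) (range1 (suc k)))
                                           (ρBlocks (λ m → J (k ∸ m)) (range1 (suc k)))
                          ≡ ρBlocks (λ m → sign (k ∸ m)) (range1 (suc k))
J-blocks-subTwice k =
  zipWith-ρBlocks-range1 subTwice subTwice-linear (suc k)
    (λ m → J (suc k ∸ m)) (λ m → J (k ∸ m)) (λ m → sign (k ∸ m)) entry
  where
  entry : ∀ m → m < suc k → subTwice (J (suc k ∸ m)) (J (k ∸ m)) ≡ sign (k ∸ m)
  entry m m<1+k rewrite suc-∸ {k} {m} (ℕₚ.≤-pred m<1+k) = J-alternating (k ∸ m)

diagA-suc : ∀ k → diagA (suc (suc k)) ≡ zipWith addTwice (diagA (suc k)) (diagB (suc k))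
                                       ++ zipWith subTwice (diagA (suc k)) (diagB (suc k))
diagA-suc k = cong₂ _∷_ (J-recurrence (suc k)) (cong₂ _∷_ (J-recurrence k) (begin
  ρBlocks (λ m → J (suc K ∸ m)) (range1 (suc K))
    ≡⟨ cong (ρBlocks (λ m → J (suc K ∸ m))) (range1-suc k) ⟩
  ρBlocks (λ m → J (suc K ∸ m)) (range1 K ++ [ K ])
    ≡⟨ ρBlocks-snoc (λ m → J (suc K ∸ m)) (range1 K) K ⟩
  ρBlocks (λ m → J (suc K ∸ m)) (range1 K) ++ scaleV (J (suc K ∸ K)) (ρpow K)
    ≡⟨ cong₂ _++_ (sym (J-blocks-addTwice k)) last-block ⟩
  zipWith addTwice (ρBlocks (λ m → J (K ∸ m)) (range1 K)) (ρBlocks (λ m → J (k ∸ m)) (range1 K))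
    ++ zipWith subTwice (diagA K) (diagB K) ∎))
  where
  open ≡-Reasoning
  K = suc k
  last-block : scaleV (J (suc K ∸ K)) (ρpow K) ≡ zipWith subTwice (diagA K) (diagB K)
  last-block = begin
    scaleV (J (suc K ∸ K)) (ρpow K) ≡⟨ cong (λ n → scaleV (J n) (ρpow K)) (ℕₚ.m+n∸n≡m 1 K) ⟩
    scaleV (+ 1) (ρpow K)           ≡⟨ scaleV-one (ρpow K) ⟩
    ρpow K                          ≡⟨ ρpow-as-blocks k ⟩
    sign K ∷ sign k ∷ ρBlocks (λ m → sign (k ∸ m)) (range1 K)
      ≡⟨ cong₂ _∷_ (sym (J-alternating K)) (cong₂ _∷_ (sym (J-alternating k)) (sym (J-blocks-subTwice k))) ⟩
    zipWith subTwice (diagA K) (diagB K) ∎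

diagB-suc : ∀ k → diagB (suc (suc k)) ≡ diagA (suc k) ++ map (λ _ → + 0) (ρpow (suc k))
diagB-suc k = cong (λ t → J (suc K) ∷ J K ∷ t) (begin
  ρBlocks (λ m → J (K ∸ m)) (range1 (suc K))
    ≡⟨ cong (ρBlocks (λ m → J (K ∸ m))) (range1-suc k) ⟩
  ρBlocks (λ m → J (K ∸ m)) (range1 K ++ [ K ])
    ≡⟨ ρBlocks-snoc (λ m → J (K ∸ m)) (range1 K) K ⟩
  ρBlocks (λ m → J (K ∸ m)) (range1 K) ++ scaleV (J (K ∸ K)) (ρpow K)
    ≡⟨ cong (λ n → ρBlocks (λ m → J (K ∸ m)) (range1 K) ++ scaleV (J n) (ρpow K)) (ℕₚ.n∸n≡0 K) ⟩
  ρBlocks (λ m → J (K ∸ m)) (range1 K) ++ map (λ _ → + 0) (ρpow K) ∎)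
  where
  open ≡-Reasoning
  K = suc k

diagQ-zeros : ∀ k (u : List ℤ) → diagQ k (map (λ _ → + 0) u) ≡ zeroQ k
diagQ-zeros zero    []      = refl
diagQ-zeros zero    (x ∷ u) = refl
diagQ-zeros (suc k) u       =
  cong₄ quad (trans (cong (diagQ k) (Listₚ.take-map (dim k) u)) (diagQ-zeros k (take (dim k) u))) refl refl
             (trans (cong (diagQ k) (Listₚ.drop-map (dim k) u)) (diagQ-zeros k (drop (dim k) u)))

length-diagA-diagB : ∀ k → length (diagA (suc k)) ≡ dim (suc k) × length (diagB (suc k)) ≡ dim (suc k)
length-diagA-diagB zero    = refl , refl
length-diagA-diagB (suc k) with length-diagA-diagB k
... | lA , lB = lengthA , lengthB
  where
  open ≡-Reasoning
  K = suc k
  lengthA : length (diagA (suc K)) ≡ dim (suc K)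
  lengthA = begin
    length (diagA (suc K))
      ≡⟨ cong length (diagA-suc k) ⟩
    length (zipWith addTwice (diagA K) (diagB K) ++ zipWith subTwice (diagA K) (diagB K))
      ≡⟨ Listₚ.length-++ (zipWith addTwice (diagA K) (diagB K)) ⟩
    length (zipWith addTwice (diagA K) (diagB K)) +ℕ length (zipWith subTwice (diagA K) (diagB K))
      ≡⟨ cong₂ _+ℕ_ (length-zipWith-≡ addTwice (diagA K) (diagB K) lA lB)
                    (length-zipWith-≡ subTwice (diagA K) (diagB K) lA lB) ⟩
    dim (suc K) ∎
  lengthB : length (diagB (suc K)) ≡ dim (suc K)
  lengthB = begin
    length (diagB (suc K))
      ≡⟨ cong length (diagB-suc k) ⟩
    length (diagA K ++ map (λ _ → + 0) (ρpow K))
      ≡⟨ Listₚ.length-++ (diagA K) ⟩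
    length (diagA K) +ℕ length (map (λ _ → + 0) (ρpow K))
      ≡⟨ cong₂ _+ℕ_ lA (Listₚ.length-map _ (ρpow K)) ⟩
    dim K +ℕ length (ρpow K)
      ≡⟨ cong (dim K +ℕ_) (length-ρpow K) ⟩
    dim (suc K) ∎

diagQ-diagA-suc : ∀ k → let U = diagQ (suc k) (diagA (suc k)); W = diagQ (suc k) (diagB (suc k)) in
  diagQ (suc (suc k)) (diagA (suc (suc k)))
    ≡ quad (zipWithQ (suc k) addTwice U W) (zeroQ (suc k)) (zeroQ (suc k)) (zipWithQ (suc k) subTwice U W)
diagQ-diagA-suc k = begin
  diagQ (suc K) (diagA (suc K))
    ≡⟨ cong (diagQ (suc K)) (diagA-suc k) ⟩
  diagQ (suc K) (zipWith addTwice (diagA K) (diagB K) ++ zipWith subTwice (diagA K) (diagB K))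
    ≡⟨ diagQ-++ K (zipWith addTwice (diagA K) (diagB K)) _ (length-zipWith-≡ addTwice (diagA K) (diagB K) lA lB) ⟩
  quad (diagQ K (zipWith addTwice (diagA K) (diagB K))) (zeroQ K)
       (zeroQ K) (diagQ K (zipWith subTwice (diagA K) (diagB K)))
    ≡⟨ cong₂ (λ X Y → quad X (zeroQ K) (zeroQ K) Y)
             (diagQ-zipWith K addTwice refl (diagA K) (diagB K) (trans lA (sym lB)))
             (diagQ-zipWith K subTwice refl (diagA K) (diagB K) (trans lA (sym lB))) ⟩
  quad (zipWithQ K addTwice (diagQ K (diagA K)) (diagQ K (diagB K))) (zeroQ K)
       (zeroQ K) (zipWithQ K subTwice (diagQ K (diagA K)) (diagQ K (diagB K))) ∎
  where
  open ≡-Reasoning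
  K = suc k
  lA = proj₁ (length-diagA-diagB k)
  lB = proj₂ (length-diagA-diagB k)

diagQ-diagB-suc : ∀ k → diagQ (suc (suc k)) (diagB (suc (suc k)))
                        ≡ quad (diagQ (suc k) (diagA (suc k))) (zeroQ (suc k)) (zeroQ (suc k)) (zeroQ (suc k))
diagQ-diagB-suc k = begin
  diagQ (suc K) (diagB (suc K))
    ≡⟨ cong (diagQ (suc K)) (diagB-suc k) ⟩
  diagQ (suc K) (diagA K ++ map (λ _ → + 0) (ρpow K))
    ≡⟨ diagQ-++ K (diagA K) (map (λ _ → + 0) (ρpow K)) (proj₁ (length-diagA-diagB k)) ⟩
  quad (diagQ K (diagA K)) (zeroQ K) (zeroQ K) (diagQ K (map (λ _ → + 0) (ρpow K)))
    ≡⟨ cong (quad (diagQ K (diagA K)) (zeroQ K) (zeroQ K)) (diagQ-zeros K (ρpow K)) ⟩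
  quad (diagQ K (diagA K)) (zeroQ K) (zeroQ K) (zeroQ K) ∎
  where
  open ≡-Reasoning
  K = suc k

scaleQ : ∀ k → ℤ → Q k → Q k
scaleQ k c = mapQ k (c *_)

conjQ-hadamard-φ : ∀ k →
  conjQ (suc k) (hadamardQ (suc k)) (φ1Q (suc k))
    ≡ scaleQ (suc k) ((+ 2) ^ suc k) (diagQ (suc k) (diagA (suc k)))
  × conjQ (suc k) (hadamardQ (suc k)) (φ0Q (suc k))
    ≡ scaleQ (suc k) ((+ 2) ^ suc (suc k)) (diagQ (suc k) (diagB (suc k)))
conjQ-hadamard-φ zero    = refl , refl
conjQ-hadamard-φ (suc k) with conjQ-hadamard-φ k
... | eq₁ , eq₀ = conj-φ1 , conj-φ0
  where
  K = suc k
  t = (+ 2) ^ K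
  h = hadamardQ K
  U = diagQ K (diagA K)
  W = diagQ K (diagB K)
  entry : ∀ e e′ → (∀ x y → evalℤ e x y ≡ evalℤ e′ x y) → evalQ K e U W ≡ evalQ K e′ U W
  entry e e′ eq = entrywise-identity K e e′ eq U W
  zero-entry : ∀ c → ∀ (x y : ℤ) → + 0 ≡ c * + 0
  zero-entry c _ _ = sym (ℤₚ.*-zeroʳ c)
  sum-entry : ∀ t x y → + 2 * (t * x + + 2 * t * y) ≡ + 2 * t * (x + + 2 * y)
  sum-entry = solve-∀
  difference-entry : ∀ t x y → + 2 * (t * x - + 2 * t * y) ≡ + 2 * t * (x - + 2 * y)
  difference-entry = solve-∀
  double-entry : ∀ t x → + 2 * (t * x + t * x) ≡ + 2 * (+ 2 * t) * x
  double-entry = solve-∀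
  cancel-entry : ∀ t x → + 2 * (t * x - t * x) ≡ + 2 * (+ 2 * t) * + 0
  cancel-entry = solve-∀

  conj-φ1 : conjQ (suc K) (hadamardQ (suc K)) (φ1Q (suc K))
            ≡ scaleQ (suc K) (+ 2 * t) (diagQ (suc K) (diagA (suc K)))
  conj-φ1 = begin
    conjQ (suc K) (hadamardQ (suc K)) (φ1Q (suc K))
      ≡⟨ conjQ-hadamard-block K h (φ1Q K) (φ0Q K) ⟩
    quad (zipWithQ K twiceSum (conjQ K h (φ1Q K)) (conjQ K h (φ0Q K))) (zeroQ K)
         (zeroQ K) (zipWithQ K twiceDifference (conjQ K h (φ1Q K)) (conjQ K h (φ0Q K)))
      ≡⟨ cong₂ (λ A B → quad (zipWithQ K twiceSum A B) (zeroQ K)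
                             (zeroQ K) (zipWithQ K twiceDifference A B)) eq₁ eq₀ ⟩
    quad (zipWithQ K twiceSum (scaleQ K t U) (scaleQ K (+ 2 * t) W)) (zeroQ K)
         (zeroQ K) (zipWithQ K twiceDifference (scaleQ K t U) (scaleQ K (+ 2 * t) W))
      ≡⟨ cong₄ quad (entry (‵op₂ twiceSum (‵op₁ (t *_) ‵x) (‵op₁ (+ 2 * t *_) ‵y))
                           (‵op₁ (+ 2 * t *_) (‵op₂ addTwice ‵x ‵y)) (sum-entry t))
                    (entry ‵0 (‵op₁ (+ 2 * t *_) ‵0) (zero-entry (+ 2 * t)))
                    (entry ‵0 (‵op₁ (+ 2 * t *_) ‵0) (zero-entry (+ 2 * t)))
                    (entry (‵op₂ twiceDifference (‵op₁ (t *_) ‵x) (‵op₁ (+ 2 * t *_) ‵y))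
                           (‵op₁ (+ 2 * t *_) (‵op₂ subTwice ‵x ‵y)) (difference-entry t)) ⟩
    scaleQ (suc K) (+ 2 * t) (quad (zipWithQ K addTwice U W) (zeroQ K) (zeroQ K) (zipWithQ K subTwice U W))
      ≡⟨ cong (scaleQ (suc K) (+ 2 * t)) (diagQ-diagA-suc k) ⟨
    scaleQ (suc K) (+ 2 * t) (diagQ (suc K) (diagA (suc K))) ∎
    where open ≡-Reasoning

  conj-φ0 : conjQ (suc K) (hadamardQ (suc K)) (φ0Q (suc K))
            ≡ scaleQ (suc K) (+ 2 * (+ 2 * t)) (diagQ (suc K) (diagB (suc K)))
  conj-φ0 = begin
    conjQ (suc K) (hadamardQ (suc K)) (φ0Q (suc K))
      ≡⟨ conjQ-hadamard-block K h (φ1Q K) (φ1Q K) ⟩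
    quad (zipWithQ K twiceSum (conjQ K h (φ1Q K)) (conjQ K h (φ1Q K))) (zeroQ K)
         (zeroQ K) (zipWithQ K twiceDifference (conjQ K h (φ1Q K)) (conjQ K h (φ1Q K)))
      ≡⟨ cong (λ A → quad (zipWithQ K twiceSum A A) (zeroQ K) (zeroQ K) (zipWithQ K twiceDifference A A)) eq₁ ⟩
    quad (zipWithQ K twiceSum (scaleQ K t U) (scaleQ K t U)) (zeroQ K)
         (zeroQ K) (zipWithQ K twiceDifference (scaleQ K t U) (scaleQ K t U))
      ≡⟨ cong₄ quad (entry (‵op₂ twiceSum (‵op₁ (t *_) ‵x) (‵op₁ (t *_) ‵x)) (‵op₁ (c *_) ‵x)
                           (λ x _ → double-entry t x))
                    (entry ‵0 (‵op₁ (c *_) ‵0) (zero-entry c))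
                    (entry ‵0 (‵op₁ (c *_) ‵0) (zero-entry c))
                    (entry (‵op₂ twiceDifference (‵op₁ (t *_) ‵x) (‵op₁ (t *_) ‵x)) (‵op₁ (c *_) ‵0)
                           (λ x _ → cancel-entry t x)) ⟩
    scaleQ (suc K) c (quad U (zeroQ K) (zeroQ K) (zeroQ K))
      ≡⟨ cong (scaleQ (suc K) c) (diagQ-diagB-suc k) ⟨
    scaleQ (suc K) c (diagQ (suc K) (diagB (suc K))) ∎
    where
    open ≡-Reasoning
    c = + 2 * (+ 2 * t)

conjugate-by-H : ∀ k p {φ} c d → φ ≡ ⟦ k ⟧ p → length d ≡ dim k →
                 conjQ k (hadamardQ k) p ≡ scaleQ k c (diagQ k d) → (H k ⊗ φ) ⊗ H k ≡ scaleM c (diag d)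
conjugate-by-H k p c d refl length-d eq rewrite H-⟦⟧ k = begin
  (⟦ k ⟧ (hadamardQ k) ⊗ ⟦ k ⟧ p) ⊗ ⟦ k ⟧ (hadamardQ k)
    ≡⟨ cong (_⊗ ⟦ k ⟧ (hadamardQ k)) (⊗-⟦⟧ k (hadamardQ k) p) ⟩
  ⟦ k ⟧ (mulQ k (hadamardQ k) p) ⊗ ⟦ k ⟧ (hadamardQ k)
    ≡⟨ ⊗-⟦⟧ k (mulQ k (hadamardQ k) p) (hadamardQ k) ⟩
  ⟦ k ⟧ (conjQ k (hadamardQ k) p)
    ≡⟨ cong ⟦ k ⟧ eq ⟩
  ⟦ k ⟧ (scaleQ k c (diagQ k d))
    ≡⟨ map-⟦⟧ k (c *_) (diagQ k d) ⟨
  scaleM c (⟦ k ⟧ (diagQ k d))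
    ≡⟨ cong (scaleM c) (diag-⟦⟧ k d length-d) ⟨
  scaleM c (diag d) ∎
  where open ≡-Reasoning

theorem3 : (k : ℕ) → 1 ≤ k →
    ((H k ⊗ φ1 k) ⊗ H k ≡ scaleM ((+ 2) ^ k) (diag (diagA k)))
    × ((H k ⊗ φ0 k) ⊗ H k ≡ scaleM ((+ 2) ^ suc k) (diag (diagB k)))
theorem3 (suc k) _ =
  conjugate-by-H (suc k) (φ1Q (suc k)) ((+ 2) ^ suc k) (diagA (suc k)) (proj₁ (φ-⟦⟧ (suc k)))
                 (proj₁ (length-diagA-diagB k)) (proj₁ (conjQ-hadamard-φ k)) ,
  conjugate-by-H (suc k) (φ0Q (suc k)) ((+ 2) ^ suc (suc k)) (diagB (suc k)) (proj₂ (φ-⟦⟧ (suc k)))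
                 (proj₂ (length-diagA-diagB k)) (proj₂ (conjQ-hadamard-φ k))
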